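{- Let $L_3(n)$ denote the number of $3$-by-$n$ Latin rectangles on $\{1,\dots,n\}$, $n\ge1$. For a vector $s=(s_{abc})_{a,b,c\in\{0,1\}}$ put \begin{align*} &f_1=s_{000}+s_{010}+s_{001}+s_{011},\quad f_2=s_{000}+s_{100}+s_{001}+s_{101},\quad f_3=s_{000}+s_{100}+s_{010}+s_{110},\\ &f_{1,2}=s_{000}+s_{001},\quad f_{1,3}=s_{000}+s_{010},\quad f_{2,3}=s_{000}+s_{100},\quad f_{1,2,3}=s_{000}. \end{align*} Then \[ L_3(n)=\sum_{s}(-1)^{\sum_{abc}(a+b+c)s_{abc}}\binom{n}{(s_{abc})_{abc}}\big[f_1f_2f_3-f_{1,2}f_3-f_{2,3}f_1-f_{1,3}f_2+2f_{1,2,3}\big]^n, \] summed over all vectors $s$ of nonnegative integers with $\sum_{abc}s_{abc}=n$, where the binomial symbol is the multinomial coefficient.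
   Context: A $k$-by-$n$ Latin rectangle on $\{1,\dots,n\}$ is a $k\times n$ matrix with entries in $\{1,\dots,n\}$ such that no row and no column contains a repeated entry. -}

module Defs where

open import Data.Nat using (ℕ; zero; suc; _+_; _*_; _∸_)
open import Data.Nat.Combinatorics using (_C_)
open import Data.Fin using (Fin; zero; suc; toℕ; combine)
open import Data.Fin.Properties using () renaming (_≟_ to _≟ᶠ_)
open import Data.List using (List; []; _∷_; map; concatMap; length; filter; upTo; allFin)
open import Data.Vec using (Vec; []; _∷_; lookup; toList)
import Data.Vec as Vec
open import Data.Vec.Relation.Unary.All using (All; all?)
open import Data.List.Relation.Unary.Unique.Propositional using (Unique)
import Data.List.Relation.Unary.Unique.DecPropositional as UDec
open import Data.Product using (_×_)
open import Relation.Nullary using (Dec)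
open import Relation.Nullary.Decidable using (_×-dec_)
open import Data.Integer using (ℤ; +_; -_; _-_) renaming (_+_ to _+ℤ_; _*_ to _*ℤ_; _^_ to _^ℤ_)
import Data.List as L
open import Data.Nat.ListAction using () renaming (sum to sumℕ)

Matrix : ℕ → ℕ → Set
Matrix k n = Vec (Vec (Fin n) n) k

column : ∀ {k n} → Matrix k n → Fin n → Vec (Fin n) k
column M j = Vec.map (λ r → lookup r j) M

IsLatinRectangle : ∀ {k n} → Matrix k n → Set
IsLatinRectangle {k} {n} M =
  All (λ r → Unique (toList r)) M ×
  All (λ j → Unique (toList (column M j))) (Vec.allFin n)

isLatin? : ∀ {k n} (M : Matrix k n) → Dec (IsLatinRectangle M)
isLatin? {k} {n} M =
  all? (λ r → UDec.unique? _≟ᶠ_ (toList r)) M ×-dec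
  all? (λ j → UDec.unique? _≟ᶠ_ (toList (column M j))) (Vec.allFin n)

allVecs : ∀ {A : Set} → List A → (k : ℕ) → List (Vec A k)
allVecs xs zero = [] ∷ []
allVecs xs (suc k) = concatMap (λ x → map (x ∷_) (allVecs xs k)) xs

allMatrices : (k n : ℕ) → List (Matrix k n)
allMatrices k n = allVecs (allVecs (allFin n) n) k

latinCount : ℕ → ℕ → ℕ
latinCount k n = length (filter isLatin? (allMatrices k n))

L₃ : ℕ → ℕ
L₃ n = latinCount 3 n

compositions : (k n : ℕ) → List (Vec ℕ k)
compositions zero zero = [] ∷ []
compositions zero (suc n) = []
compositions (suc k) n =
  concatMap (λ i → map (i ∷_) (compositions k (n ∸ i))) (upTo (suc n))

multinomial : ∀ {k} → Vec ℕ k → ℕ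
multinomial [] = 1
multinomial (x ∷ xs) = ((x + Vec.sum xs) C x) * multinomial xs

-- s is indexed by (a,b,c) ∈ {0,1}³ via position 4a + 2b + c in a Vec ℕ 8
S : Set
S = Vec ℕ 8

s_ : S → Fin 2 → Fin 2 → Fin 2 → ℕ
s_ s a b c = lookup s (combine (combine a b) c)

𝟘 𝟙 : Fin 2
𝟘 = zero
𝟙 = suc zero

bits : List (Fin 2)
bits = 𝟘 ∷ 𝟙 ∷ []

signExponent : S → ℕ
signExponent s =
  sumℕ (L.map (λ a → sumℕ (L.map (λ b → sumℕ (L.map (λ c →
    (toℕ a + toℕ b + toℕ c) * s_ s a b c) bits)) bits)) bits)

f₁ f₂ f₃ f₁₂ f₁₃ f₂₃ f₁₂₃ : S → ℤ
f₁ s = + (s_ s 𝟘 𝟘 𝟘 + s_ s 𝟘 𝟙 𝟘 + s_ s 𝟘 𝟘 𝟙 + s_ s 𝟘 𝟙 𝟙)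
f₂ s = + (s_ s 𝟘 𝟘 𝟘 + s_ s 𝟙 𝟘 𝟘 + s_ s 𝟘 𝟘 𝟙 + s_ s 𝟙 𝟘 𝟙)
f₃ s = + (s_ s 𝟘 𝟘 𝟘 + s_ s 𝟙 𝟘 𝟘 + s_ s 𝟘 𝟙 𝟘 + s_ s 𝟙 𝟙 𝟘)
f₁₂ s = + (s_ s 𝟘 𝟘 𝟘 + s_ s 𝟘 𝟘 𝟙)
f₁₃ s = + (s_ s 𝟘 𝟘 𝟘 + s_ s 𝟘 𝟙 𝟘)
f₂₃ s = + (s_ s 𝟘 𝟘 𝟘 + s_ s 𝟙 𝟘 𝟘)
f₁₂₃ s = + (s_ s 𝟘 𝟘 𝟘)

bracket : S → ℤ
bracket s = f₁ s *ℤ f₂ s *ℤ f₃ s - f₁₂ s *ℤ f₃ s - f₂₃ s *ℤ f₁ s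
            - f₁₃ s *ℤ f₂ s +ℤ (+ 2) *ℤ f₁₂₃ s

term : ℕ → S → ℤ
term n s = ((- (+ 1)) ^ℤ signExponent s) *ℤ (+ multinomial s) *ℤ (bracket s ^ℤ n)

sumℤ : List ℤ → ℤ
sumℤ = L.foldr _+ℤ_ (+ 0)

RHS : ℕ → ℤ
RHS n = sumℤ (L.map (term n) (compositions 8 n))

{-# OPTIONS --safe #-}
-- A 3 × n array over {1,…,n} is a Latin rectangle iff every row hits every value (for a row of
-- length n this is the same as having no repeated entry) and every column has three distinct
-- entries.  For a single value v, inclusion–exclusion over the set of rows required to miss v
-- writes [all three rows hit v] as a signed sum over labels in {0,1}³, so the count becomes a
-- signed sum over labellings τ of the values.  For fixed τ the remaining conditions act column by
-- column, and τ contributes ±C(τ)ⁿ, where C(τ) is the number of triples of distinct values whose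
-- j-th entry may appear in row j; inclusion–exclusion over coincidences evaluates C(τ) as the
-- bracket at the histogram s of τ.  The sign and C(τ) depend on τ only through s, and exactly
-- multinomial(s) labellings have histogram s.
module Submission where

open import Level using (0ℓ)
open import Function using (_∘_; id)
open import Function.Bundles using (_⇔_; mk⇔; Equivalence)
import Function.Properties.Equivalence as ⇔
open import Data.Bool using (if_then_else_)
open import Data.Unit using (tt)
open import Data.Product using (∃-syntax; _×_; _,_; proj₁; proj₂)
open import Data.Nat as ℕ using (ℕ; zero; suc; _∸_; _≥_)
import Data.Nat.Properties as ℕₚ
open import Data.Nat.Combinatorics using (_C_; k>n⇒nCk≡0; nCk+nC[k+1]≡[n+1]C[k+1])
open import Data.Integer as ℤ using (ℤ; +_; _+_; _*_; _-_; _^_; 0ℤ; 1ℤ; -1ℤ)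
import Data.Integer.Properties as ℤₚ
open import Data.Integer.Tactic.RingSolver using (solve-∀)
open import Data.Fin using (Fin; zero; suc; toℕ; _↑ˡ_; _↑ʳ_; punchOut; quotient; remainder; combine)
open import Data.Fin.Properties
  using (_≟_; all?; any?; ∀-cons-⇔; punchOut-injective; injective⇒≤; 0≢1+n; suc-injective; toℕ<n; remQuot-combine)
open import Data.List as List using (List; []; _∷_; _++_; concatMap; applyUpTo; upTo; allFin)
open import Data.List.Relation.Unary.All as ListAll using ([]; _∷_)
open import Data.List.Relation.Unary.All.Properties using (applyUpTo⁺₁; concat⁺) renaming (map⁺ to ListAll-map⁺)
open import Data.List.Relation.Unary.AllPairs using ([]; _∷_)
open import Data.List.Relation.Unary.Unique.Propositional using (Unique)
open import Data.Vec as Vec using (Vec; []; _∷_; lookup)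
open import Data.Vec.Properties using (lookup∘updateAt; lookup∘updateAt′; lookup-replicate)
open import Data.Vec.Relation.Unary.All using ([]; _∷_)
open import Data.Vec.Relation.Unary.All.Properties using (lookup⁺; lookup⁻; toList⁺; toList⁻; tabulate⁺; tabulate⁻)
open import Relation.Binary.PropositionalEquality
open import Relation.Nullary using (Dec; yes; no; does; ¬?; contradiction)
open import Relation.Nullary.Decidable using (_×-dec_; _→-dec_; does-⇔; True; toWitness)
open import Relation.Unary using (Pred; Decidable)
open import Algebra.Properties.Semiring.Sum ℤₚ.+-*-semiring
open import Algebra.Properties.CommutativeMonoid.Sum ℤₚ.*-1-commutativeMonoid
  using () renaming (sum to ∏; sum-cong-≗ to ∏-cong; ∑-distrib-+ to ∏-distrib-*)
open import Algebra.Properties.CommutativeSemigroup ℤₚ.+-commutativeSemigroup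
  using (interchange) renaming (x∙yz≈y∙xz to +-left-comm)
import Algebra.Properties.Semiring.Sum ℕₚ.+-*-semiring as ℕ∑
open import Algebra.Properties.CommutativeSemigroup ℕₚ.+-commutativeSemigroup
  using () renaming (x∙yz≈y∙xz to ℕ-+-left-comm)
open import Defs

private
  variable
    A B : Set
    P Q R : Set
    m n : ℕ

infixl 10 ∏-syntax ∑∈

∏-syntax : ∀ n → (Fin n → ℤ) → ℤ
∏-syntax _ = ∏

syntax ∏-syntax n (λ i → x) = ∏[ i < n ] x

∑∈ : List A → (A → ℤ) → ℤ
∑∈ xs f = sumℤ (List.map f xs)

syntax ∑∈ xs (λ x → e) = ∑[ x ∈ xs ] e

∑∈-cong : ∀ (xs : List A) {f g : A → ℤ} → (∀ x → f x ≡ g x) → ∑∈ xs f ≡ ∑∈ xs g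
∑∈-cong []       f≗g = refl
∑∈-cong (x ∷ xs) f≗g = cong₂ _+_ (f≗g x) (∑∈-cong xs f≗g)

∑∈-cong-All : ∀ {xs : List A} {f g : A → ℤ} → ListAll.All (λ x → f x ≡ g x) xs → ∑∈ xs f ≡ ∑∈ xs g
∑∈-cong-All []            = refl
∑∈-cong-All (fx≡gx ∷ f≗g) = cong₂ _+_ fx≡gx (∑∈-cong-All f≗g)

∑∈-++ : ∀ (xs ys : List A) (f : A → ℤ) → ∑∈ (xs ++ ys) f ≡ ∑∈ xs f + ∑∈ ys f
∑∈-++ []       ys f = sym (ℤₚ.+-identityˡ _)
∑∈-++ (x ∷ xs) ys f = trans (cong (_+_ (f x)) (∑∈-++ xs ys f)) (sym (ℤₚ.+-assoc (f x) _ _))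

∑∈-map : (g : B → A) (xs : List B) (f : A → ℤ) → ∑∈ (List.map g xs) f ≡ ∑∈ xs (f ∘ g)
∑∈-map g []       f = refl
∑∈-map g (x ∷ xs) f = cong (_+_ (f (g x))) (∑∈-map g xs f)

∑∈-concatMap : (g : B → List A) (xs : List B) (f : A → ℤ) → ∑∈ (concatMap g xs) f ≡ ∑[ x ∈ xs ] ∑∈ (g x) f
∑∈-concatMap g []       f = refl
∑∈-concatMap g (x ∷ xs) f =
  trans (∑∈-++ (g x) (concatMap g xs) f) (cong (_+_ (∑∈ (g x) f)) (∑∈-concatMap g xs f))

∑∈-distrib-+ : ∀ (xs : List A) (f g : A → ℤ) → ∑[ x ∈ xs ] (f x + g x) ≡ ∑∈ xs f + ∑∈ xs g
∑∈-distrib-+ []       f g = refl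
∑∈-distrib-+ (x ∷ xs) f g = trans (cong (_+_ (f x + g x)) (∑∈-distrib-+ xs f g)) (interchange (f x) (g x) _ _)

*-distribˡ-∑∈ : ∀ c (xs : List A) (f : A → ℤ) → c * ∑∈ xs f ≡ ∑[ x ∈ xs ] (c * f x)
*-distribˡ-∑∈ c []       f = ℤₚ.*-zeroʳ c
*-distribˡ-∑∈ c (x ∷ xs) f = trans (ℤₚ.*-distribˡ-+ c (f x) _) (cong (_+_ (c * f x)) (*-distribˡ-∑∈ c xs f))

*-distribʳ-∑∈ : ∀ c (xs : List A) (f : A → ℤ) → ∑∈ xs f * c ≡ ∑[ x ∈ xs ] (f x * c)
*-distribʳ-∑∈ c xs f =
  trans (ℤₚ.*-comm _ c) (trans (*-distribˡ-∑∈ c xs f) (∑∈-cong xs λ x → ℤₚ.*-comm c (f x)))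

∑∈-zero : ∀ (xs : List A) → ∑[ x ∈ xs ] 0ℤ ≡ 0ℤ
∑∈-zero []       = refl
∑∈-zero (x ∷ xs) = trans (ℤₚ.+-identityˡ _) (∑∈-zero xs)

∑∈-comm : (xs : List A) (ys : List B) (f : A → B → ℤ) →
          ∑[ x ∈ xs ] ∑[ y ∈ ys ] f x y ≡ ∑[ y ∈ ys ] ∑[ x ∈ xs ] f x y
∑∈-comm []       ys f = sym (∑∈-zero ys)
∑∈-comm (x ∷ xs) ys f =
  trans (cong (_+_ (∑∈ ys (f x))) (∑∈-comm xs ys f)) (sym (∑∈-distrib-+ ys (f x) _))

∑∈-tabulate : ∀ {n} (g : Fin n → A) (f : A → ℤ) → ∑∈ (List.tabulate g) f ≡ ∑[ i < n ] f (g i)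
∑∈-tabulate {n = zero}  g f = refl
∑∈-tabulate {n = suc n} g f = cong (_+_ (f (g zero))) (∑∈-tabulate (g ∘ suc) f)

∑∈-allFin : ∀ (f : Fin n → ℤ) → ∑[ x ∈ allFin n ] f x ≡ sum f
∑∈-allFin f = ∑∈-tabulate id f

∑∈-applyUpTo : ∀ (h : ℕ → A) n (f : A → ℤ) → ∑∈ (applyUpTo h n) f ≡ ∑[ i < n ] f (h (toℕ i))
∑∈-applyUpTo h zero    f = refl
∑∈-applyUpTo h (suc n) f = cong (_+_ (f (h 0))) (∑∈-applyUpTo (h ∘ suc) n f)

∑∈-allVecs : ∀ (xs : List A) k (f : Vec A (suc k) → ℤ) →
             ∑[ v ∈ allVecs xs (suc k) ] f v ≡ ∑[ x ∈ xs ] ∑[ v ∈ allVecs xs k ] f (x ∷ v)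
∑∈-allVecs xs k f = trans (∑∈-concatMap _ xs f) (∑∈-cong xs λ x → ∑∈-map (x ∷_) (allVecs xs k) f)

∑-snoc : ∀ n (f : ℕ → ℤ) → ∑[ i < suc n ] f (toℕ i) ≡ ∑[ i < n ] f (toℕ i) + f n
∑-snoc zero    f = trans (ℤₚ.+-identityʳ (f 0)) (sym (ℤₚ.+-identityˡ (f 0)))
∑-snoc (suc n) f = trans (cong (_+_ (f 0)) (∑-snoc n (f ∘ suc))) (sym (ℤₚ.+-assoc (f 0) _ (f (suc n))))

∑-*-∑ : (f g : Fin n → ℤ) → ∑[ x < n ] ∑[ y < n ] (f x * g y) ≡ sum f * sum g
∑-*-∑ f g = trans (sum-cong-≗ λ x → sym (*-distribˡ-sum (f x) g)) (sym (*-distribʳ-sum (sum g) f))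

∑³ : (Fin n → Fin n → Fin n → ℤ) → ℤ
∑³ {n = n} f = ∑[ x < n ] ∑[ y < n ] ∑[ z < n ] f x y z

∏-const : ∀ n (x : ℤ) → ∏[ i < n ] x ≡ x ^ n
∏-const zero    x = refl
∏-const (suc n) x = cong (x *_) (∏-const n x)

∏-distrib-*₃ : (f g h : Fin n → ℤ) → ∏[ i < n ] (f i * (g i * h i)) ≡ ∏ f * (∏ g * ∏ h)
∏-distrib-*₃ f g h = trans (∏-distrib-* f _) (cong (∏ f *_) (∏-distrib-* g h))

∏-∑∈ : ∀ (xs : List A) n (g : Fin n → A → ℤ) →
       ∏[ j < n ] ∑[ x ∈ xs ] g j x ≡ ∑[ v ∈ allVecs xs n ] ∏[ j < n ] g j (lookup v j)
∏-∑∈ xs zero    g = sym (ℤₚ.+-identityʳ 1ℤ)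
∏-∑∈ xs (suc n) g = begin
  ∑∈ xs (g zero) * ∏[ j < n ] ∑∈ xs (g (suc j))         ≡⟨ cong (∑∈ xs (g zero) *_) (∏-∑∈ xs n (g ∘ suc)) ⟩
  ∑∈ xs (g zero) * ∑∈ (allVecs xs n) rest               ≡⟨ *-distribʳ-∑∈ _ xs (g zero) ⟩
  ∑[ x ∈ xs ] (g zero x * ∑∈ (allVecs xs n) rest)
    ≡⟨ ∑∈-cong xs (λ x → *-distribˡ-∑∈ (g zero x) (allVecs xs n) rest) ⟩
  ∑[ x ∈ xs ] ∑[ v ∈ allVecs xs n ] (g zero x * rest v) ≡⟨ ∑∈-allVecs xs n _ ⟨
  ∑[ v ∈ allVecs xs (suc n) ] ∏[ j < suc n ] g j (lookup v j) ∎
  where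
  open ≡-Reasoning
  rest : Vec _ n → ℤ
  rest v = ∏[ j < n ] g (suc j) (lookup v j)

∑-matrices : ∀ (xs : List A) k n (g : Fin n → Vec A k → ℤ) →
             ∑[ M ∈ allVecs (allVecs xs n) k ] ∏[ c < n ] g c (Vec.map (λ r → lookup r c) M) ≡
             ∏[ c < n ] ∑[ v ∈ allVecs xs k ] g c v
∑-matrices xs zero    n g = trans (ℤₚ.+-identityʳ _) (∏-cong λ c → sym (ℤₚ.+-identityʳ (g c [])))
∑-matrices xs (suc k) n g = begin
  ∑[ M ∈ allVecs (allVecs xs n) (suc k) ] ∏[ c < n ] g c (Vec.map (λ r → lookup r c) M)
    ≡⟨ ∑∈-allVecs (allVecs xs n) k _ ⟩
  ∑[ r ∈ allVecs xs n ] ∑[ M ∈ allVecs (allVecs xs n) k ]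
    ∏[ c < n ] g c (lookup r c ∷ Vec.map (λ r → lookup r c) M)
    ≡⟨ ∑∈-cong (allVecs xs n) (λ r → ∑-matrices xs k n (λ c v → g c (lookup r c ∷ v))) ⟩
  ∑[ r ∈ allVecs xs n ] ∏[ c < n ] ∑[ v ∈ allVecs xs k ] g c (lookup r c ∷ v)
    ≡⟨ ∏-∑∈ xs n (λ c x → ∑[ v ∈ allVecs xs k ] g c (x ∷ v)) ⟨
  ∏[ c < n ] ∑[ x ∈ xs ] ∑[ v ∈ allVecs xs k ] g c (x ∷ v)
    ≡⟨ ∏-cong (λ c → ∑∈-allVecs xs k (g c)) ⟨
  ∏[ c < n ] ∑[ v ∈ allVecs xs (suc k) ] g c v ∎
  where open ≡-Reasoning

∑-columns : ∀ (f : Vec (Fin n) 3 → ℤ) → ∑[ v ∈ allVecs (allFin n) 3 ] f v ≡ ∑³ (λ x y z → f (x ∷ y ∷ z ∷ []))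
∑-columns {n = n} f = begin
  ∑[ v ∈ allVecs (allFin n) 3 ] f v
    ≡⟨ ∑∈-allVecs (allFin n) 2 f ⟩
  ∑[ x ∈ allFin n ] ∑[ v ∈ allVecs (allFin n) 2 ] f (x ∷ v)
    ≡⟨ ∑∈-cong (allFin n) (λ x → ∑∈-allVecs (allFin n) 1 (f ∘ (x ∷_))) ⟩
  ∑[ x ∈ allFin n ] ∑[ y ∈ allFin n ] ∑[ v ∈ allVecs (allFin n) 1 ] f (x ∷ y ∷ v)
    ≡⟨ (∑∈-cong (allFin n) λ x → ∑∈-cong (allFin n) λ y → trans (∑∈-allVecs (allFin n) 0 (λ v → f (x ∷ y ∷ v)))
         (∑∈-cong (allFin n) λ z → ℤₚ.+-identityʳ (f (x ∷ y ∷ z ∷ [])))) ⟩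
  ∑[ x ∈ allFin n ] ∑[ y ∈ allFin n ] ∑[ z ∈ allFin n ] f (x ∷ y ∷ z ∷ [])
    ≡⟨ (∑∈-cong (allFin n) λ x → ∑∈-cong (allFin n) λ y → ∑∈-allFin (λ z → f (x ∷ y ∷ z ∷ []))) ⟩
  ∑[ x ∈ allFin n ] ∑[ y ∈ allFin n ] ∑[ z < n ] f (x ∷ y ∷ z ∷ [])
    ≡⟨ (∑∈-cong (allFin n) λ x → ∑∈-allFin (λ y → ∑[ z < n ] f (x ∷ y ∷ z ∷ []))) ⟩
  ∑[ x ∈ allFin n ] ∑[ y < n ] ∑[ z < n ] f (x ∷ y ∷ z ∷ [])
    ≡⟨ ∑∈-allFin (λ x → ∑[ y < n ] ∑[ z < n ] f (x ∷ y ∷ z ∷ [])) ⟩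
  ∑³ (λ x y z → f (x ∷ y ∷ z ∷ [])) ∎
  where open ≡-Reasoning

χ : Dec P → ℤ
χ P? = if does P? then 1ℤ else 0ℤ

χ-⇔ : P ⇔ Q → (P? : Dec P) (Q? : Dec Q) → χ P? ≡ χ Q?
χ-⇔ P⇔Q P? Q? = cong (if_then 1ℤ else 0ℤ) (does-⇔ P⇔Q P? Q?)

χ-× : (P? : Dec P) (Q? : Dec Q) → χ (P? ×-dec Q?) ≡ χ P? * χ Q?
χ-× (yes _) Q? = sym (ℤₚ.*-identityˡ (χ Q?))
χ-× (no _)  Q? = refl

χ-∀ : ∀ {n} {Q : Pred (Fin n) 0ℓ} (Q? : Decidable Q) (∀Q? : Dec (∀ i → Q i)) →
      χ ∀Q? ≡ ∏[ i < n ] χ (Q? i)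
χ-∀ {n = zero}  Q? ∀Q? = χ-⇔ (mk⇔ (λ _ → tt) (λ _ ())) ∀Q? (yes tt)
χ-∀ {n = suc n} Q? ∀Q? = begin
  χ ∀Q?                                    ≡⟨ χ-⇔ (⇔.sym ∀-cons-⇔) ∀Q? (Q? zero ×-dec all? (Q? ∘ suc)) ⟩
  χ (Q? zero ×-dec all? (Q? ∘ suc))        ≡⟨ χ-× (Q? zero) (all? (Q? ∘ suc)) ⟩
  χ (Q? zero) * χ (all? (Q? ∘ suc))        ≡⟨ cong (χ (Q? zero) *_) (χ-∀ (Q? ∘ suc) (all? (Q? ∘ suc))) ⟩
  χ (Q? zero) * ∏[ i < n ] χ (Q? (suc i))  ∎
  where open ≡-Reasoning

length-filter : ∀ {P : Pred A 0ℓ} (P? : Decidable P) (xs : List A) →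
                + List.length (List.filter P? xs) ≡ ∑[ x ∈ xs ] χ (P? x)
length-filter P? []       = refl
length-filter P? (x ∷ xs) with P? x
... | yes _ = cong (_+_ 1ℤ) (length-filter P? xs)
... | no  _ = trans (length-filter P? xs) (sym (ℤₚ.+-identityˡ _))

δ : Fin n → Fin n → ℤ
δ x y = χ (x ≟ y)

∑-δ : (x : Fin n) (f : Fin n → ℤ) → ∑[ y < n ] (δ x y * f y) ≡ f x
∑-δ {n = suc n} zero    f = begin
  1ℤ * f zero + ∑[ y < n ] 0ℤ  ≡⟨ cong₂ _+_ (ℤₚ.*-identityˡ (f zero)) (sum-replicate-zero n) ⟩
  f zero + 0ℤ                  ≡⟨ ℤₚ.+-identityʳ (f zero) ⟩
  f zero                       ∎
  where open ≡-Reasoning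
∑-δ {n = suc n} (suc x) f = trans (ℤₚ.+-identityˡ _) (∑-δ x (f ∘ suc))

-- Latin rectangles as hitting and distinctness conditions

Hits : Vec (Fin n) m → Fin n → Set
Hits r v = ∃[ c ] lookup r c ≡ v

hits? : (r : Vec (Fin n) m) → Decidable (Hits r)
hits? r v = any? λ c → lookup r c ≟ v

∏-χ-hits→ : (r : Vec (Fin n) m) {Q : Pred (Fin n) 0ℓ} (Q? : Decidable Q) →
            ∏[ v < n ] χ (hits? r v →-dec Q? v) ≡ ∏[ c < m ] χ (Q? (lookup r c))
∏-χ-hits→ {n = n} {m = m} r {Q} Q? = begin
  ∏[ v < n ] χ (hits? r v →-dec Q? v)  ≡⟨ χ-∀ (λ v → hits? r v →-dec Q? v) hits⊆Q? ⟨
  χ hits⊆Q?                            ≡⟨ χ-⇔ hits⊆Q⇔ hits⊆Q? (all? (Q? ∘ lookup r)) ⟩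
  χ (all? (Q? ∘ lookup r))             ≡⟨ χ-∀ (Q? ∘ lookup r) (all? (Q? ∘ lookup r)) ⟩
  ∏[ c < m ] χ (Q? (lookup r c))       ∎
  where
  open ≡-Reasoning
  hits⊆Q? : Dec (∀ v → Hits r v → Q v)
  hits⊆Q? = all? λ v → hits? r v →-dec Q? v
  hits⊆Q⇔ : (∀ v → Hits r v → Q v) ⇔ (∀ c → Q (lookup r c))
  hits⊆Q⇔ = mk⇔ (λ h c → h (lookup r c) (c , refl)) (λ { h v (c , refl) → h c })

injective⇒surjective : (f : Fin n → Fin n) → (∀ {i j} → f i ≡ f j → i ≡ j) → ∀ v → ∃[ i ] f i ≡ v
injective⇒surjective {suc n} f f-inj v with any? (λ i → f i ≟ v)
... | yes hit  = hit
... | no  miss = contradiction (injective⇒≤ g-inj) ℕₚ.1+n≰n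
  where
  v≢f : ∀ i → v ≢ f i
  v≢f i v≡fi = miss (i , sym v≡fi)
  g : Fin (suc n) → Fin n
  g i = punchOut (v≢f i)
  g-inj : ∀ {i j} → g i ≡ g j → i ≡ j
  g-inj {i} {j} gi≡gj = f-inj (punchOut-injective (v≢f i) (v≢f j) gi≡gj)

module _ (f : Fin n → Fin n) (f-surj : ∀ v → ∃[ i ] f i ≡ v) where

  private
    section : Fin n → Fin n
    section v = proj₁ (f-surj v)

    f∘section : ∀ v → f (section v) ≡ v
    f∘section v = proj₂ (f-surj v)

    section-surjective : ∀ i → ∃[ v ] section v ≡ i
    section-surjective = injective⇒surjective section λ {a} {b} e →
      trans (sym (f∘section a)) (trans (cong f e) (f∘section b))

  surjective⇒injective : ∀ {i j} → f i ≡ f j → i ≡ j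
  surjective⇒injective {i} {j} fi≡fj with section-surjective i | section-surjective j
  ... | a , refl | b , refl = cong section (trans (sym (f∘section a)) (trans fi≡fj (f∘section b)))

Unique⇒lookup-injective : (r : Vec A m) → Unique (Vec.toList r) → ∀ {i j} → lookup r i ≡ lookup r j → i ≡ j
Unique⇒lookup-injective (x ∷ r) (x∉r ∷ u) {zero}  {zero}  _ = refl
Unique⇒lookup-injective (x ∷ r) (x∉r ∷ u) {zero}  {suc j} e = contradiction e (lookup⁺ (toList⁻ x∉r) j)
Unique⇒lookup-injective (x ∷ r) (x∉r ∷ u) {suc i} {zero}  e = contradiction (sym e) (lookup⁺ (toList⁻ x∉r) i)
Unique⇒lookup-injective (x ∷ r) (x∉r ∷ u) {suc i} {suc j} e = cong suc (Unique⇒lookup-injective r u e)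

lookup-injective⇒Unique : (r : Vec A m) → (∀ {i j} → lookup r i ≡ lookup r j → i ≡ j) → Unique (Vec.toList r)
lookup-injective⇒Unique []      _   = []
lookup-injective⇒Unique (x ∷ r) inj =
  toList⁺ (lookup⁻ λ j x≡rj → 0≢1+n (inj x≡rj)) ∷ lookup-injective⇒Unique r (suc-injective ∘ inj)

Unique⇔hitsAll : (r : Vec (Fin n) n) → Unique (Vec.toList r) ⇔ (∀ v → Hits r v)
Unique⇔hitsAll r = mk⇔
  (λ u → injective⇒surjective (lookup r) (Unique⇒lookup-injective r u))
  (λ h → lookup-injective⇒Unique r (surjective⇒injective (lookup r) h))

Distinct : A → A → A → Set
Distinct x y z = x ≢ y × x ≢ z × y ≢ z

distinct? : (x y z : Fin n) → Dec (Distinct x y z)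
distinct? x y z = ¬? (x ≟ y) ×-dec ¬? (x ≟ z) ×-dec ¬? (y ≟ z)

Unique⇔Distinct : ∀ {x y z : A} → Unique (x ∷ y ∷ z ∷ []) ⇔ Distinct x y z
Unique⇔Distinct = mk⇔
  (λ { ((x≢y ∷ x≢z ∷ []) ∷ (y≢z ∷ []) ∷ [] ∷ []) → x≢y , x≢z , y≢z })
  (λ { (x≢y , x≢z , y≢z) → (x≢y ∷ x≢z ∷ []) ∷ (y≢z ∷ []) ∷ [] ∷ [] })

isLatin₃⇔ : (r₁ r₂ r₃ : Vec (Fin n) n) →
            IsLatinRectangle (r₁ ∷ r₂ ∷ r₃ ∷ []) ⇔
            ((∀ v → Hits r₁ v × Hits r₂ v × Hits r₃ v) ×
             (∀ c → Distinct (lookup r₁ c) (lookup r₂ c) (lookup r₃ c)))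
isLatin₃⇔ r₁ r₂ r₃ = mk⇔
  (λ { ((u₁ ∷ u₂ ∷ u₃ ∷ []) , cols) →
       (λ v → to (Unique⇔hitsAll r₁) u₁ v , to (Unique⇔hitsAll r₂) u₂ v , to (Unique⇔hitsAll r₃) u₃ v)
     , (λ c → to Unique⇔Distinct (tabulate⁻ cols c)) })
  (λ { (hits , distinct) →
       (from (Unique⇔hitsAll r₁) (proj₁ ∘ hits) ∷ from (Unique⇔hitsAll r₂) (proj₁ ∘ proj₂ ∘ hits)
         ∷ from (Unique⇔hitsAll r₃) (proj₂ ∘ proj₂ ∘ hits) ∷ [])
     , tabulate⁺ (λ c → from Unique⇔Distinct (distinct c)) })
  where open Equivalence

χ-isLatin₃ : (r₁ r₂ r₃ : Vec (Fin n) n) →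
             χ (isLatin? (r₁ ∷ r₂ ∷ r₃ ∷ [])) ≡
             ∏[ v < n ] (χ (hits? r₁ v) * (χ (hits? r₂ v) * χ (hits? r₃ v))) *
             ∏[ c < n ] χ (distinct? (lookup r₁ c) (lookup r₂ c) (lookup r₃ c))
χ-isLatin₃ {n = n} r₁ r₂ r₃ = begin
  χ (isLatin? (r₁ ∷ r₂ ∷ r₃ ∷ []))
    ≡⟨ χ-⇔ (isLatin₃⇔ r₁ r₂ r₃) (isLatin? (r₁ ∷ r₂ ∷ r₃ ∷ [])) (all? hits₃? ×-dec all? distinct₃?) ⟩
  χ (all? hits₃? ×-dec all? distinct₃?)
    ≡⟨ χ-× (all? hits₃?) (all? distinct₃?) ⟩
  χ (all? hits₃?) * χ (all? distinct₃?)
    ≡⟨ cong₂ _*_ (χ-∀ hits₃? (all? hits₃?)) (χ-∀ distinct₃? (all? distinct₃?)) ⟩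
  ∏[ v < n ] χ (hits₃? v) * ∏[ c < n ] χ (distinct₃? c)
    ≡⟨ cong (_* ∏[ c < n ] χ (distinct₃? c)) (∏-cong λ v →
         trans (χ-× (hits? r₁ v) (hits? r₂ v ×-dec hits? r₃ v))
               (cong (χ (hits? r₁ v) *_) (χ-× (hits? r₂ v) (hits? r₃ v)))) ⟩
  ∏[ v < n ] (χ (hits? r₁ v) * (χ (hits? r₂ v) * χ (hits? r₃ v))) * ∏[ c < n ] χ (distinct₃? c) ∎
  where
  open ≡-Reasoning
  hits₃? : Decidable λ v → Hits r₁ v × Hits r₂ v × Hits r₃ v
  hits₃? v = hits? r₁ v ×-dec hits? r₂ v ×-dec hits? r₃ v
  distinct₃? : Decidable λ c → Distinct (lookup r₁ c) (lookup r₂ c) (lookup r₃ c)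
  distinct₃? c = distinct? (lookup r₁ c) (lookup r₂ c) (lookup r₃ c)

-- Inclusion–exclusion over the rows missing a value

-- The label combine (combine a b) c stands for (a, b, c), the position of s_abc in S; bit j of a
-- label is 1 when row j is required to miss the value carrying it.
Label : Set
Label = Fin 8

bit₁ bit₂ bit₃ : Label → Fin 2
bit₁ ℓ = quotient {2} 2 (quotient {4} 2 ℓ)
bit₂ ℓ = remainder {2} 2 (quotient {4} 2 ℓ)
bit₃ ℓ = remainder {4} 2 ℓ

allowed₁? : (ℓ : Label) → Dec (bit₁ ℓ ≡ zero)
allowed₁? ℓ = bit₁ ℓ ≟ zero

allowed₂? : (ℓ : Label) → Dec (bit₂ ℓ ≡ zero)
allowed₂? ℓ = bit₂ ℓ ≟ zero

allowed₃? : (ℓ : Label) → Dec (bit₃ ℓ ≡ zero)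
allowed₃? ℓ = bit₃ ℓ ≟ zero

α₁ α₂ α₃ : Label → ℤ
α₁ ℓ = χ (allowed₁? ℓ)
α₂ ℓ = χ (allowed₂? ℓ)
α₃ ℓ = χ (allowed₃? ℓ)

weight : Label → ℕ
weight ℓ = toℕ (bit₁ ℓ) ℕ.+ toℕ (bit₂ ℓ) ℕ.+ toℕ (bit₃ ℓ)

sign : Label → ℤ
sign ℓ = -1ℤ ^ weight ℓ

-- p₁ p₂ p₃ = ∏ⱼ (1 − (1 − pⱼ)) expanded over the subsets of rows; as both sides depend only on
-- the three decisions, it is checked case by case.
inclusion–exclusion₃ : (P? : Dec P) (Q? : Dec Q) (R? : Dec R) →
  χ P? * (χ Q? * χ R?) ≡
  ∑[ ℓ < 8 ] (sign ℓ * (χ (P? →-dec allowed₁? ℓ) *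
                        (χ (Q? →-dec allowed₂? ℓ) * χ (R? →-dec allowed₃? ℓ))))
inclusion–exclusion₃ (yes _) (yes _) (yes _) = refl
inclusion–exclusion₃ (yes _) (yes _) (no _)  = refl
inclusion–exclusion₃ (yes _) (no _)  (yes _) = refl
inclusion–exclusion₃ (yes _) (no _)  (no _)  = refl
inclusion–exclusion₃ (no _)  (yes _) (yes _) = refl
inclusion–exclusion₃ (no _)  (yes _) (no _)  = refl
inclusion–exclusion₃ (no _)  (no _)  (yes _) = refl
inclusion–exclusion₃ (no _)  (no _)  (no _)  = refl

labellings : (n : ℕ) → List (Vec Label n)
labellings n = allVecs (allFin 8) n

sgn : Vec Label n → ℤ
sgn τ = ∏[ v < _ ] sign (lookup τ v)

labelTerm : (r₁ r₂ r₃ : Vec (Fin n) n) → Fin n → Label → ℤ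
labelTerm r₁ r₂ r₃ v ℓ =
  sign ℓ * (χ (hits? r₁ v →-dec allowed₁? ℓ) *
            (χ (hits? r₂ v →-dec allowed₂? ℓ) * χ (hits? r₃ v →-dec allowed₃? ℓ)))

∏-labelTerm : (r₁ r₂ r₃ : Vec (Fin n) n) (τ : Vec Label n) →
  ∏[ v < n ] labelTerm r₁ r₂ r₃ v (lookup τ v) ≡
  sgn τ * ∏[ c < n ] (α₁ (lookup τ (lookup r₁ c)) *
                     (α₂ (lookup τ (lookup r₂ c)) * α₃ (lookup τ (lookup r₃ c))))
∏-labelTerm {n = n} r₁ r₂ r₃ τ = begin
  ∏[ v < n ] labelTerm r₁ r₂ r₃ v (lookup τ v)
    ≡⟨ ∏-distrib-* (sign ∘ lookup τ) (λ v → h₁ v * (h₂ v * h₃ v)) ⟩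
  sgn τ * ∏[ v < n ] (h₁ v * (h₂ v * h₃ v))
    ≡⟨ cong (sgn τ *_) (∏-distrib-*₃ h₁ h₂ h₃) ⟩
  sgn τ * (∏ h₁ * (∏ h₂ * ∏ h₃))
    ≡⟨ cong (sgn τ *_) (cong₂ _*_ (∏-χ-hits→ r₁ (allowed₁? ∘ lookup τ))
                                   (cong₂ _*_ (∏-χ-hits→ r₂ (allowed₂? ∘ lookup τ))
                                              (∏-χ-hits→ r₃ (allowed₃? ∘ lookup τ)))) ⟩
  sgn τ * (∏ a₁ * (∏ a₂ * ∏ a₃))
    ≡⟨ cong (sgn τ *_) (∏-distrib-*₃ a₁ a₂ a₃) ⟨
  sgn τ * ∏[ c < n ] (a₁ c * (a₂ c * a₃ c)) ∎
  where
  open ≡-Reasoning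
  h₁ h₂ h₃ a₁ a₂ a₃ : Fin n → ℤ
  h₁ v = χ (hits? r₁ v →-dec allowed₁? (lookup τ v))
  h₂ v = χ (hits? r₂ v →-dec allowed₂? (lookup τ v))
  h₃ v = χ (hits? r₃ v →-dec allowed₃? (lookup τ v))
  a₁ c = α₁ (lookup τ (lookup r₁ c))
  a₂ c = α₂ (lookup τ (lookup r₂ c))
  a₃ c = α₃ (lookup τ (lookup r₃ c))

columnWeight : Vec Label n → Vec (Fin n) 3 → ℤ
columnWeight τ (x ∷ y ∷ z ∷ []) = α₁ (lookup τ x) * (α₂ (lookup τ y) * α₃ (lookup τ z)) * χ (distinct? x y z)

χ-isLatin-expansion : (M : Matrix 3 n) →
  χ (isLatin? M) ≡ ∑[ τ ∈ labellings n ] (sgn τ * ∏[ c < n ] columnWeight τ (column M c))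
χ-isLatin-expansion {n = n} M@(r₁ ∷ r₂ ∷ r₃ ∷ []) = begin
  χ (isLatin? M)
    ≡⟨ χ-isLatin₃ r₁ r₂ r₃ ⟩
  ∏[ v < n ] (χ (hits? r₁ v) * (χ (hits? r₂ v) * χ (hits? r₃ v))) * D
    ≡⟨ cong (_* D) (∏-cong λ v → inclusion–exclusion₃ (hits? r₁ v) (hits? r₂ v) (hits? r₃ v)) ⟩
  ∏[ v < n ] ∑[ ℓ < 8 ] labelTerm r₁ r₂ r₃ v ℓ * D
    ≡⟨ cong (_* D) (∏-cong λ v → ∑∈-allFin (labelTerm r₁ r₂ r₃ v)) ⟨
  ∏[ v < n ] ∑[ ℓ ∈ allFin 8 ] labelTerm r₁ r₂ r₃ v ℓ * D
    ≡⟨ cong (_* D) (∏-∑∈ (allFin 8) n (labelTerm r₁ r₂ r₃)) ⟩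
  ∑[ τ ∈ labellings n ] ∏[ v < n ] labelTerm r₁ r₂ r₃ v (lookup τ v) * D
    ≡⟨ *-distribʳ-∑∈ D (labellings n) _ ⟩
  ∑[ τ ∈ labellings n ] (∏[ v < n ] labelTerm r₁ r₂ r₃ v (lookup τ v) * D)
    ≡⟨ ∑∈-cong (labellings n) (λ τ →
         trans (cong (_* D) (∏-labelTerm r₁ r₂ r₃ τ))
               (trans (ℤₚ.*-assoc (sgn τ) _ D) (cong (sgn τ *_) (sym (∏-distrib-* (allowed τ) distinct))))) ⟩
  ∑[ τ ∈ labellings n ] (sgn τ * ∏[ c < n ] columnWeight τ (column M c)) ∎
  where
  open ≡-Reasoning
  distinct : Fin n → ℤ
  distinct c = χ (distinct? (lookup r₁ c) (lookup r₂ c) (lookup r₃ c))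
  D : ℤ
  D = ∏ distinct
  allowed : Vec Label n → Fin n → ℤ
  allowed τ c = α₁ (lookup τ (lookup r₁ c)) * (α₂ (lookup τ (lookup r₂ c)) * α₃ (lookup τ (lookup r₃ c)))

latin₃-count : ∀ n →
  + L₃ n ≡ ∑[ τ ∈ labellings n ] (sgn τ * (∑[ v ∈ allVecs (allFin n) 3 ] columnWeight τ v) ^ n)
latin₃-count n = begin
  + L₃ n
    ≡⟨ length-filter isLatin? (allMatrices 3 n) ⟩
  ∑[ M ∈ allMatrices 3 n ] χ (isLatin? M)
    ≡⟨ ∑∈-cong (allMatrices 3 n) χ-isLatin-expansion ⟩
  ∑[ M ∈ allMatrices 3 n ] ∑[ τ ∈ labellings n ] (sgn τ * ∏[ c < n ] columnWeight τ (column M c))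
    ≡⟨ ∑∈-comm (allMatrices 3 n) (labellings n) _ ⟩
  ∑[ τ ∈ labellings n ] ∑[ M ∈ allMatrices 3 n ] (sgn τ * ∏[ c < n ] columnWeight τ (column M c))
    ≡⟨ ∑∈-cong (labellings n) (λ τ → *-distribˡ-∑∈ (sgn τ) (allMatrices 3 n) _) ⟨
  ∑[ τ ∈ labellings n ] (sgn τ * ∑[ M ∈ allMatrices 3 n ] ∏[ c < n ] columnWeight τ (column M c))
    ≡⟨ ∑∈-cong (labellings n) (λ τ → cong (sgn τ *_)
         (trans (∑-matrices (allFin n) 3 n (λ _ → columnWeight τ)) (∏-const n _))) ⟩
  ∑[ τ ∈ labellings n ] (sgn τ * (∑[ v ∈ allVecs (allFin n) 3 ] columnWeight τ v) ^ n) ∎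
  where open ≡-Reasoning

-- Triples of distinct values

χ-distinct : (x y z : Fin n) → χ (distinct? x y z) ≡ 1ℤ - δ x y - δ x z - δ y z + + 2 * (δ x y * δ y z)
χ-distinct x y z with x ≟ y | x ≟ z | y ≟ z
... | yes x≡y | yes x≡z | no  y≢z = contradiction (trans (sym x≡y) x≡z) y≢z
... | yes x≡y | no  x≢z | yes y≡z = contradiction (trans x≡y y≡z) x≢z
... | no  x≢y | yes x≡z | yes y≡z = contradiction (trans x≡z (sym y≡z)) x≢y
... | yes _   | yes _   | yes _   = refl
... | yes _   | no  _   | no  _   = refl
... | no  _   | yes _   | no  _   = refl
... | no  _   | no  _   | yes _   = refl
... | no  _   | no  _   | no  _   = refl

∑-linear : ∀ c (f g h k l : Fin n → ℤ) →
  ∑[ i < n ] (f i - g i - h i - k i + c * l i) ≡ sum f - sum g - sum h - sum k + c * sum l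
∑-linear {n = zero}  c f g h k l = sym (trans (ℤₚ.+-identityˡ _) (ℤₚ.*-zeroʳ c))
∑-linear {n = suc n} c f g h k l =
  trans (cong (_+_ (f zero - g zero - h zero - k zero + c * l zero))
              (∑-linear c (f ∘ suc) (g ∘ suc) (h ∘ suc) (k ∘ suc) (l ∘ suc)))
        (step (f zero) (g zero) (h zero) (k zero) (l zero) c _ _ _ _ _)
  where
  step : ∀ f g h k l c F G H K L →
         (f - g - h - k + c * l) + (F - G - H - K + c * L) ≡ (f + F) - (g + G) - (h + H) - (k + K) + c * (l + L)
  step = solve-∀

∑³-linear : ∀ c (f g h k l : Fin n → Fin n → Fin n → ℤ) →
  ∑³ (λ x y z → f x y z - g x y z - h x y z - k x y z + c * l x y z) ≡
  ∑³ f - ∑³ g - ∑³ h - ∑³ k + c * ∑³ l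
∑³-linear {n = n} c f g h k l =
  trans (sum-cong-≗ λ x → trans (sum-cong-≗ λ y → ∑-linear c (f x y) (g x y) (h x y) (k x y) (l x y))
                                (∑-linear c (∑₁ f x) (∑₁ g x) (∑₁ h x) (∑₁ k x) (∑₁ l x)))
        (∑-linear c (∑₂ f) (∑₂ g) (∑₂ h) (∑₂ k) (∑₂ l))
  where
  ∑₁ : (Fin n → Fin n → Fin n → ℤ) → Fin n → Fin n → ℤ
  ∑₁ t x y = ∑[ z < n ] t x y z
  ∑₂ : (Fin n → Fin n → Fin n → ℤ) → Fin n → ℤ
  ∑₂ t x = ∑[ y < n ] ∑[ z < n ] t x y z

bracketOf : (f₁ f₂ f₃ f₁₂ f₂₃ f₁₃ f₁₂₃ : ℤ) → ℤ
bracketOf f₁ f₂ f₃ f₁₂ f₂₃ f₁₃ f₁₂₃ = f₁ * f₂ * f₃ - f₁₂ * f₃ - f₂₃ * f₁ - f₁₃ * f₂ + + 2 * f₁₂₃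

bracketOf-cong : ∀ {a b c ab bc ac abc a′ b′ c′ ab′ bc′ ac′ abc′} →
  a ≡ a′ → b ≡ b′ → c ≡ c′ → ab ≡ ab′ → bc ≡ bc′ → ac ≡ ac′ → abc ≡ abc′ →
  bracketOf a b c ab bc ac abc ≡ bracketOf a′ b′ c′ ab′ bc′ ac′ abc′
bracketOf-cong refl refl refl refl refl refl refl = refl

module _ {n} (A₁ A₂ A₃ : Fin n → ℤ) where

  private
    w : Fin n → Fin n → Fin n → ℤ
    w x y z = A₁ x * (A₂ y * A₃ z)

    ∑³-w : ∑³ w ≡ sum A₁ * (sum A₂ * sum A₃)
    ∑³-w = trans (sum-cong-≗ λ x → trans (∑∑-*ˡ (A₁ x)) (cong (A₁ x *_) (∑-*-∑ A₂ A₃)))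
                 (sym (*-distribʳ-sum _ A₁))
      where
      ∑∑-*ˡ : ∀ a → ∑[ y < n ] ∑[ z < n ] (a * (A₂ y * A₃ z)) ≡ a * ∑[ y < n ] ∑[ z < n ] (A₂ y * A₃ z)
      ∑∑-*ˡ a = trans (sum-cong-≗ λ y → sym (*-distribˡ-sum a λ z → A₂ y * A₃ z))
                      (sym (*-distribˡ-sum a λ y → ∑[ z < n ] (A₂ y * A₃ z)))

    ∑³-x≡y : ∑³ (λ x y z → δ x y * w x y z) ≡ ∑[ v < n ] (A₁ v * A₂ v) * sum A₃
    ∑³-x≡y = trans (sum-cong-≗ λ x → begin
      ∑[ y < n ] ∑[ z < n ] (δ x y * w x y z)  ≡⟨ sum-cong-≗ (λ y → *-distribˡ-sum (δ x y) (w x y)) ⟨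
      ∑[ y < n ] (δ x y * ∑[ z < n ] w x y z)  ≡⟨ ∑-δ x (λ y → ∑[ z < n ] w x y z) ⟩
      ∑[ z < n ] (A₁ x * (A₂ x * A₃ z))        ≡⟨ sum-cong-≗ (λ z → ℤₚ.*-assoc (A₁ x) (A₂ x) (A₃ z)) ⟨
      ∑[ z < n ] (A₁ x * A₂ x * A₃ z)          ≡⟨ *-distribˡ-sum (A₁ x * A₂ x) A₃ ⟨
      A₁ x * A₂ x * sum A₃                     ∎)
      (sym (*-distribʳ-sum (sum A₃) λ v → A₁ v * A₂ v))
      where open ≡-Reasoning

    ∑³-x≡z : ∑³ (λ x y z → δ x z * w x y z) ≡ ∑[ v < n ] (A₁ v * A₃ v) * sum A₂
    ∑³-x≡z = trans (sum-cong-≗ λ x → sum-cong-≗ λ y → trans (∑-δ x (w x y)) (swap (A₁ x) (A₂ y) (A₃ x)))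
                   (∑-*-∑ (λ v → A₁ v * A₃ v) A₂)
      where
      swap : ∀ a b c → a * (b * c) ≡ a * c * b
      swap = solve-∀

    ∑³-y≡z : ∑³ (λ x y z → δ y z * w x y z) ≡ sum A₁ * ∑[ v < n ] (A₂ v * A₃ v)
    ∑³-y≡z = trans (sum-cong-≗ λ x → sum-cong-≗ λ y → ∑-δ y (w x y)) (∑-*-∑ A₁ λ v → A₂ v * A₃ v)

    ∑³-x≡y≡z : ∑³ (λ x y z → δ x y * (δ y z * w x y z)) ≡ ∑[ v < n ] (A₁ v * (A₂ v * A₃ v))
    ∑³-x≡y≡z = sum-cong-≗ λ x → begin
      ∑[ y < n ] ∑[ z < n ] (δ x y * (δ y z * w x y z))
        ≡⟨ sum-cong-≗ (λ y → *-distribˡ-sum (δ x y) λ z → δ y z * w x y z) ⟨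
      ∑[ y < n ] (δ x y * ∑[ z < n ] (δ y z * w x y z))
        ≡⟨ sum-cong-≗ (λ y → cong (δ x y *_) (∑-δ y (w x y))) ⟩
      ∑[ y < n ] (δ x y * w x y y)
        ≡⟨ ∑-δ x (λ y → w x y y) ⟩
      w x x x ∎
      where open ≡-Reasoning

  ∑-distinct-triples :
    ∑³ (λ x y z → A₁ x * (A₂ y * A₃ z) * χ (distinct? x y z)) ≡
    bracketOf (sum A₁) (sum A₂) (sum A₃) (∑[ v < n ] (A₁ v * A₂ v)) (∑[ v < n ] (A₂ v * A₃ v))
              (∑[ v < n ] (A₁ v * A₃ v)) (∑[ v < n ] (A₁ v * (A₂ v * A₃ v)))
  ∑-distinct-triples = begin
    ∑³ (λ x y z → w x y z * χ (distinct? x y z))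
      ≡⟨ (sum-cong-≗ λ x → sum-cong-≗ λ y → sum-cong-≗ λ z →
           trans (cong (w x y z *_) (χ-distinct x y z)) (expand (w x y z) (δ x y) (δ x z) (δ y z))) ⟩
    ∑³ (λ x y z → w x y z - δ x y * w x y z - δ x z * w x y z - δ y z * w x y z
                  + + 2 * (δ x y * (δ y z * w x y z)))
      ≡⟨ ∑³-linear (+ 2) w (λ x y z → δ x y * w x y z) (λ x y z → δ x z * w x y z) (λ x y z → δ y z * w x y z)
                   (λ x y z → δ x y * (δ y z * w x y z)) ⟩
    ∑³ w - ∑³ (λ x y z → δ x y * w x y z) - ∑³ (λ x y z → δ x z * w x y z) - ∑³ (λ x y z → δ y z * w x y z)
      + + 2 * ∑³ (λ x y z → δ x y * (δ y z * w x y z))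
      ≡⟨ cong₂ _+_ (cong₂ _-_ (cong₂ _-_ (cong₂ _-_ ∑³-w ∑³-x≡y) ∑³-x≡z) ∑³-y≡z) (cong (_*_ (+ 2)) ∑³-x≡y≡z) ⟩
    sum A₁ * (sum A₂ * sum A₃) - ∑[ v < n ] (A₁ v * A₂ v) * sum A₃ - ∑[ v < n ] (A₁ v * A₃ v) * sum A₂
      - sum A₁ * ∑[ v < n ] (A₂ v * A₃ v) + + 2 * ∑[ v < n ] (A₁ v * (A₂ v * A₃ v))
      ≡⟨ rearrange (sum A₁) (sum A₂) (sum A₃) (∑[ v < n ] (A₁ v * A₂ v)) (∑[ v < n ] (A₁ v * A₃ v))
                   (∑[ v < n ] (A₂ v * A₃ v)) (∑[ v < n ] (A₁ v * (A₂ v * A₃ v))) ⟩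
    bracketOf (sum A₁) (sum A₂) (sum A₃) (∑[ v < n ] (A₁ v * A₂ v)) (∑[ v < n ] (A₂ v * A₃ v))
              (∑[ v < n ] (A₁ v * A₃ v)) (∑[ v < n ] (A₁ v * (A₂ v * A₃ v))) ∎
    where
    open ≡-Reasoning
    expand : ∀ p dxy dxz dyz → p * (1ℤ - dxy - dxz - dyz + + 2 * (dxy * dyz)) ≡
             p - dxy * p - dxz * p - dyz * p + + 2 * (dxy * (dyz * p))
    expand = solve-∀
    rearrange : ∀ a b c ab ac bc abc → a * (b * c) - ab * c - ac * b - a * bc + + 2 * abc ≡
                a * b * c - ab * c - bc * a - ac * b + + 2 * abc
    rearrange = solve-∀

-- Histograms of labellings

histogram : ∀ {k} → Vec (Fin k) n → Vec ℕ k
histogram {k = k} []      = Vec.replicate k 0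
histogram         (ℓ ∷ τ) = Vec.updateAt (histogram τ) ℓ suc

lookup-updateAt-suc : (s : Vec ℕ m) (x ℓ : Fin m) → + lookup (Vec.updateAt s x suc) ℓ ≡ δ x ℓ + + lookup s ℓ
lookup-updateAt-suc s x ℓ with x ≟ ℓ
... | yes refl = cong +_ (lookup∘updateAt x s)
... | no  x≢ℓ  = cong +_ (lookup∘updateAt′ ℓ x (x≢ℓ ∘ sym) s)

histogram-lookup : ∀ {k} (τ : Vec (Fin k) n) (ℓ : Fin k) →
                   + lookup (histogram τ) ℓ ≡ ∑[ v < n ] δ (lookup τ v) ℓ
histogram-lookup []      ℓ = cong +_ (lookup-replicate ℓ 0)
histogram-lookup (x ∷ τ) ℓ =
  trans (lookup-updateAt-suc (histogram τ) x ℓ) (cong (_+_ (δ x ℓ)) (histogram-lookup τ ℓ))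

-- The pointwise identity between φ and a sum of δ's is decided by evaluation over the eight labels.
histogram-count₁ : (τ : Vec Label n) (φ : Label → ℤ) {i : Label} → {True (all? λ x → δ x i ℤ.≟ φ x)} →
                   + lookup (histogram τ) i ≡ ∑[ v < n ] φ (lookup τ v)
histogram-count₁ τ φ {i} {φ≡} = trans (histogram-lookup τ i) (sum-cong-≗ λ v → toWitness φ≡ (lookup τ v))

histogram-count₂ : (τ : Vec Label n) (φ : Label → ℤ) {i j : Label} →
                   {True (all? λ x → δ x i + δ x j ℤ.≟ φ x)} →
                   + (lookup (histogram τ) i ℕ.+ lookup (histogram τ) j) ≡ ∑[ v < n ] φ (lookup τ v)
histogram-count₂ τ φ {i} {j} {φ≡} = begin
  + H i + + H j                              ≡⟨ cong₂ _+_ (histogram-lookup τ i) (histogram-lookup τ j) ⟩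
  ∑[ v < _ ] D i v + ∑[ v < _ ] D j v        ≡⟨ ∑-distrib-+ (D i) (D j) ⟨
  ∑[ v < _ ] (D i v + D j v)                 ≡⟨ sum-cong-≗ (λ v → toWitness φ≡ (lookup τ v)) ⟩
  ∑[ v < _ ] φ (lookup τ v)                  ∎
  where
  open ≡-Reasoning
  H = lookup (histogram τ)
  D : Label → Fin _ → ℤ
  D ℓ v = δ (lookup τ v) ℓ

histogram-count₄ : (τ : Vec Label n) (φ : Label → ℤ) {i j k l : Label} →
                   {True (all? λ x → δ x i + δ x j + δ x k + δ x l ℤ.≟ φ x)} →
                   + (lookup (histogram τ) i ℕ.+ lookup (histogram τ) j ℕ.+
                      lookup (histogram τ) k ℕ.+ lookup (histogram τ) l) ≡
                   ∑[ v < n ] φ (lookup τ v)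
histogram-count₄ τ φ {i} {j} {k} {l} {φ≡} = begin
  + H i + + H j + + H k + + H l
    ≡⟨ cong₂ _+_ (cong₂ _+_ (cong₂ _+_ (histogram-lookup τ i) (histogram-lookup τ j)) (histogram-lookup τ k))
                 (histogram-lookup τ l) ⟩
  ∑[ v < _ ] D i v + ∑[ v < _ ] D j v + ∑[ v < _ ] D k v + ∑[ v < _ ] D l v
    ≡⟨ cong (λ t → t + ∑[ v < _ ] D k v + ∑[ v < _ ] D l v) (∑-distrib-+ (D i) (D j)) ⟨
  ∑[ v < _ ] (D i v + D j v) + ∑[ v < _ ] D k v + ∑[ v < _ ] D l v
    ≡⟨ cong (_+ ∑[ v < _ ] D l v) (∑-distrib-+ (λ v → D i v + D j v) (D k)) ⟨
  ∑[ v < _ ] (D i v + D j v + D k v) + ∑[ v < _ ] D l v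
    ≡⟨ ∑-distrib-+ (λ v → D i v + D j v + D k v) (D l) ⟨
  ∑[ v < _ ] (D i v + D j v + D k v + D l v)
    ≡⟨ sum-cong-≗ (λ v → toWitness φ≡ (lookup τ v)) ⟩
  ∑[ v < _ ] φ (lookup τ v) ∎
  where
  open ≡-Reasoning
  H = lookup (histogram τ)
  D : Label → Fin _ → ℤ
  D ℓ v = δ (lookup τ v) ℓ

∑-columnWeight : (τ : Vec Label n) → ∑[ v ∈ allVecs (allFin n) 3 ] columnWeight τ v ≡ bracket (histogram τ)
∑-columnWeight {n = n} τ = begin
  ∑[ v ∈ allVecs (allFin n) 3 ] columnWeight τ v
    ≡⟨ ∑-columns (columnWeight τ) ⟩
  ∑³ (λ x y z → A₁ x * (A₂ y * A₃ z) * χ (distinct? x y z))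
    ≡⟨ ∑-distinct-triples A₁ A₂ A₃ ⟩
  bracketOf (sum A₁) (sum A₂) (sum A₃) (∑[ v < n ] (A₁ v * A₂ v)) (∑[ v < n ] (A₂ v * A₃ v))
            (∑[ v < n ] (A₁ v * A₃ v)) (∑[ v < n ] (A₁ v * (A₂ v * A₃ v)))
    ≡⟨ bracketOf-cong (histogram-count₄ τ α₁) (histogram-count₄ τ α₂) (histogram-count₄ τ α₃)
                      (histogram-count₂ τ λ ℓ → α₁ ℓ * α₂ ℓ) (histogram-count₂ τ λ ℓ → α₂ ℓ * α₃ ℓ)
                      (histogram-count₂ τ λ ℓ → α₁ ℓ * α₃ ℓ) (histogram-count₁ τ λ ℓ → α₁ ℓ * (α₂ ℓ * α₃ ℓ)) ⟨
  bracket (histogram τ) ∎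
  where
  open ≡-Reasoning
  A₁ A₂ A₃ : Fin n → ℤ
  A₁ = α₁ ∘ lookup τ
  A₂ = α₂ ∘ lookup τ
  A₃ = α₃ ∘ lookup τ

∑-*-updateAt-suc : (w : Fin m → ℕ) (s : Vec ℕ m) (x : Fin m) →
  ℕ∑.sum (λ ℓ → w ℓ ℕ.* lookup (Vec.updateAt s x suc) ℓ) ≡ w x ℕ.+ ℕ∑.sum (λ ℓ → w ℓ ℕ.* lookup s ℓ)
∑-*-updateAt-suc w (y ∷ s) zero    =
  trans (cong (ℕ._+ ℕ∑.sum (λ ℓ → w (suc ℓ) ℕ.* lookup s ℓ)) (ℕₚ.*-suc (w zero) y)) (ℕₚ.+-assoc (w zero) _ _)
∑-*-updateAt-suc w (y ∷ s) (suc x) =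
  trans (cong (w zero ℕ.* y ℕ.+_) (∑-*-updateAt-suc (w ∘ suc) s x)) (ℕ-+-left-comm (w zero ℕ.* y) (w (suc x)) _)

∑-*-histogram : ∀ {k} (w : Fin k → ℕ) (τ : Vec (Fin k) n) →
  ℕ∑.sum (λ ℓ → w ℓ ℕ.* lookup (histogram τ) ℓ) ≡ ℕ∑.sum (λ v → w (lookup τ v))
∑-*-histogram {k = k} w [] =
  trans (ℕ∑.sum-cong-≗ λ ℓ → trans (cong (w ℓ ℕ.*_) (lookup-replicate ℓ 0)) (ℕₚ.*-zeroʳ (w ℓ)))
        (ℕ∑.sum-replicate-zero k)
∑-*-histogram w (x ∷ τ) = trans (∑-*-updateAt-suc w (histogram τ) x) (cong (w x ℕ.+_) (∑-*-histogram w τ))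

∑-↑ : ∀ m {n} (f : Fin (m ℕ.+ n) → ℕ) → ℕ∑.sum f ≡ ℕ∑.sum (λ i → f (i ↑ˡ n)) ℕ.+ ℕ∑.sum (λ j → f (m ↑ʳ j))
∑-↑ zero    f = refl
∑-↑ (suc m) f = trans (cong (f zero ℕ.+_) (∑-↑ m (f ∘ suc))) (sym (ℕₚ.+-assoc (f zero) _ _))

∑-combine : ∀ m n (f : Fin (m ℕ.* n) → ℕ) →
            ℕ∑.sum f ≡ ℕ∑.sum (λ (i : Fin m) → ℕ∑.sum (λ (j : Fin n) → f (combine i j)))
∑-combine zero    n f = refl
∑-combine (suc m) n f =
  trans (∑-↑ n f) (cong (ℕ∑.sum (λ j → f (j ↑ˡ m ℕ.* n)) ℕ.+_) (∑-combine m n (f ∘ (n ↑ʳ_))))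

weight-combine : ∀ (a b c : Fin 2) → weight (combine (combine a b) c) ≡ toℕ a ℕ.+ toℕ b ℕ.+ toℕ c
weight-combine a b c = begin
  weight (combine (combine a b) c)
    ≡⟨ cong (λ (ab , c) → toℕ (quotient {2} 2 ab) ℕ.+ toℕ (remainder {2} 2 ab) ℕ.+ toℕ c)
            (remQuot-combine (combine a b) c) ⟩
  toℕ (quotient {2} 2 (combine a b)) ℕ.+ toℕ (remainder {2} 2 (combine a b)) ℕ.+ toℕ c
    ≡⟨ cong (λ (a , b) → toℕ a ℕ.+ toℕ b ℕ.+ toℕ c) (remQuot-combine a b) ⟩
  toℕ a ℕ.+ toℕ b ℕ.+ toℕ c ∎
  where open ≡-Reasoning

signExponent≡∑ : ∀ s → signExponent s ≡ ℕ∑.sum (λ ℓ → weight ℓ ℕ.* lookup s ℓ)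
signExponent≡∑ s = sym (begin
  ℕ∑.sum (λ ℓ → weight ℓ ℕ.* lookup s ℓ)
    ≡⟨ ∑-combine 4 2 (λ ℓ → weight ℓ ℕ.* lookup s ℓ) ⟩
  ℕ∑.sum (λ (i : Fin 4) → ℕ∑.sum (λ (c : Fin 2) → weight (combine i c) ℕ.* lookup s (combine i c)))
    ≡⟨ ∑-combine 2 2 (λ i → ℕ∑.sum (λ (c : Fin 2) → weight (combine i c) ℕ.* lookup s (combine i c))) ⟩
  ℕ∑.sum (λ (a : Fin 2) → ℕ∑.sum (λ (b : Fin 2) → ℕ∑.sum (λ (c : Fin 2) →
    weight (combine (combine a b) c) ℕ.* s_ s a b c)))
    ≡⟨ (ℕ∑.sum-cong-≗ λ a → ℕ∑.sum-cong-≗ λ b → ℕ∑.sum-cong-≗ λ c →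
         cong (ℕ._* s_ s a b c) (weight-combine a b c)) ⟩
  ℕ∑.sum (λ (a : Fin 2) → ℕ∑.sum (λ (b : Fin 2) → ℕ∑.sum (λ (c : Fin 2) →
    (toℕ a ℕ.+ toℕ b ℕ.+ toℕ c) ℕ.* s_ s a b c)))
    ≡⟨⟩
  signExponent s ∎)
  where open ≡-Reasoning

^-sum : ∀ x (e : Fin n → ℕ) → x ^ ℕ∑.sum e ≡ ∏[ i < n ] (x ^ e i)
^-sum {n = zero}  x e = refl
^-sum {n = suc n} x e = trans (ℤₚ.^-distribˡ-+-* x (e zero) _) (cong (x ^ e zero *_) (^-sum x (e ∘ suc)))

sgn-histogram : (τ : Vec Label n) → sgn τ ≡ -1ℤ ^ signExponent (histogram τ)
sgn-histogram τ = sym (begin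
  -1ℤ ^ signExponent (histogram τ)                         ≡⟨ cong (-1ℤ ^_) (signExponent≡∑ (histogram τ)) ⟩
  -1ℤ ^ ℕ∑.sum (λ ℓ → weight ℓ ℕ.* lookup (histogram τ) ℓ)  ≡⟨ cong (-1ℤ ^_) (∑-*-histogram weight τ) ⟩
  -1ℤ ^ ℕ∑.sum (λ v → weight (lookup τ v))                 ≡⟨ ^-sum -1ℤ (weight ∘ lookup τ) ⟩
  sgn τ                                                    ∎)
  where open ≡-Reasoning

multinomialℤ : Vec ℕ m → ℤ
multinomialℤ s = + multinomial s

compositions-sum : ∀ k r → ListAll.All (λ s → Vec.sum s ≡ r) (compositions k r)
compositions-sum zero    zero    = refl ∷ []
compositions-sum zero    (suc r) = []
compositions-sum (suc k) r       = concat⁺ (ListAll-map⁺ (applyUpTo⁺₁ id (suc r) λ {x} x<1+r →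
  ListAll-map⁺ (ListAll.map (λ ∑t≡r∸x → trans (cong (x ℕ.+_) ∑t≡r∸x) (ℕₚ.m+[n∸m]≡n (ℕₚ.≤-pred x<1+r)))
                            (compositions-sum k (r ∸ x)))))

compositions-zero : ∀ k → compositions k 0 ≡ Vec.replicate k 0 ∷ []
compositions-zero zero    = refl
compositions-zero (suc k) = cong (λ ss → List.map (0 ∷_) ss ++ []) (compositions-zero k)

multinomial-zero : ∀ k → multinomial (Vec.replicate k 0) ≡ 1
multinomial-zero zero    = refl
multinomial-zero (suc k) = cong (1 ℕ.*_) (multinomial-zero k)

∑-compositions-suc : ∀ k r (H : Vec ℕ (suc k) → ℤ) →
  ∑[ s ∈ compositions (suc k) r ] (multinomialℤ s * H s) ≡
  ∑[ i < suc r ] (+ (r C toℕ i) * ∑[ t ∈ compositions k (r ∸ toℕ i) ] (multinomialℤ t * H (toℕ i ∷ t)))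
∑-compositions-suc k r H = begin
  ∑[ s ∈ compositions (suc k) r ] (multinomialℤ s * H s)
    ≡⟨ ∑∈-cong-All (ListAll.map split-multinomial (compositions-sum (suc k) r)) ⟩
  ∑∈ (compositions (suc k) r) H′
    ≡⟨ ∑∈-concatMap (λ x → List.map (x ∷_) (compositions k (r ∸ x))) (upTo (suc r)) H′ ⟩
  ∑[ x ∈ upTo (suc r) ] ∑∈ (List.map (x ∷_) (compositions k (r ∸ x))) H′
    ≡⟨ ∑∈-cong (upTo (suc r)) (λ x → trans (∑∈-map (x ∷_) (compositions k (r ∸ x)) H′)
                                           (sym (*-distribˡ-∑∈ (+ (r C x)) (compositions k (r ∸ x)) (rest x)))) ⟩
  ∑[ x ∈ upTo (suc r) ] (+ (r C x) * ∑∈ (compositions k (r ∸ x)) (rest x))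
    ≡⟨ ∑∈-applyUpTo id (suc r) (λ x → + (r C x) * ∑∈ (compositions k (r ∸ x)) (rest x)) ⟩
  ∑[ i < suc r ] (+ (r C toℕ i) * ∑∈ (compositions k (r ∸ toℕ i)) (rest (toℕ i))) ∎
  where
  open ≡-Reasoning
  rest : ℕ → Vec ℕ k → ℤ
  rest x t = multinomialℤ t * H (x ∷ t)
  H′ : Vec ℕ (suc k) → ℤ
  H′ (x ∷ t) = + (r C x) * rest x t
  split-multinomial : ∀ {s} → Vec.sum s ≡ r → multinomialℤ s * H s ≡ H′ s
  split-multinomial {x ∷ t} ∑s≡r = begin
    + (((x ℕ.+ Vec.sum t) C x) ℕ.* multinomial t) * H (x ∷ t)
      ≡⟨ cong (λ m → + ((m C x) ℕ.* multinomial t) * H (x ∷ t)) ∑s≡r ⟩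
    + ((r C x) ℕ.* multinomial t) * H (x ∷ t)
      ≡⟨ cong (_* H (x ∷ t)) (ℤₚ.pos-* (r C x) (multinomial t)) ⟩
    + (r C x) * multinomialℤ t * H (x ∷ t)
      ≡⟨ ℤₚ.*-assoc (+ (r C x)) (multinomialℤ t) (H (x ∷ t)) ⟩
    + (r C x) * rest x t ∎

pascal-∑ : ∀ n (F : ℕ → ℕ → ℤ) →
  ∑[ i < suc (suc n) ] (+ (suc n C toℕ i) * F (toℕ i) (suc n ∸ toℕ i)) ≡
  ∑[ i < suc n ] (+ (n C toℕ i) * F (suc (toℕ i)) (n ∸ toℕ i)) +
  ∑[ i < suc n ] (+ (n C toℕ i) * F (toℕ i) (suc (n ∸ toℕ i)))
-- The chain starts and ends with the two sides with their i = 0 terms split off (n C 0 reduces to 1).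
pascal-∑ n F = begin
  + 1 * F 0 (suc n) + ∑[ i < suc n ] (+ (suc n C suc (toℕ i)) * F (suc (toℕ i)) (n ∸ toℕ i))
    ≡⟨ cong (_+_ (+ 1 * F 0 (suc n))) (trans (sum-cong-≗ split) (∑-distrib-+ {suc n} (p ∘ toℕ) (q ∘ toℕ))) ⟩
  + 1 * F 0 (suc n) + (∑[ i < suc n ] p (toℕ i) + ∑[ i < suc n ] q (toℕ i))
    ≡⟨ +-left-comm (+ 1 * F 0 (suc n)) (∑[ i < suc n ] p (toℕ i)) (∑[ i < suc n ] q (toℕ i)) ⟩
  ∑[ i < suc n ] p (toℕ i) + (+ 1 * F 0 (suc n) + ∑[ i < suc n ] q (toℕ i))
    ≡⟨ cong (λ Q → ∑[ i < suc n ] p (toℕ i) + (+ 1 * F 0 (suc n) + Q)) drop-last ⟩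
  ∑[ i < suc n ] p (toℕ i) +
  (+ 1 * F 0 (suc n) + ∑[ i < n ] (+ (n C suc (toℕ i)) * F (suc (toℕ i)) (suc (n ∸ suc (toℕ i))))) ∎
  where
  open ≡-Reasoning
  p q : ℕ → ℤ
  p x = + (n C x) * F (suc x) (n ∸ x)
  q x = + (n C suc x) * F (suc x) (n ∸ x)
  split : ∀ (i : Fin (suc n)) → + (suc n C suc (toℕ i)) * F (suc (toℕ i)) (n ∸ toℕ i) ≡ p (toℕ i) + q (toℕ i)
  split i = trans (cong (λ c → + c * F (suc (toℕ i)) (n ∸ toℕ i)) (sym (nCk+nC[k+1]≡[n+1]C[k+1] n (toℕ i))))
                  (ℤₚ.*-distribʳ-+ (F (suc (toℕ i)) (n ∸ toℕ i)) (+ (n C toℕ i)) (+ (n C suc (toℕ i))))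
  drop-last : ∑[ i < suc n ] q (toℕ i) ≡ ∑[ i < n ] (+ (n C suc (toℕ i)) * F (suc (toℕ i)) (suc (n ∸ suc (toℕ i))))
  drop-last = begin
    ∑[ i < suc n ] q (toℕ i)    ≡⟨ ∑-snoc n q ⟩
    ∑[ i < n ] q (toℕ i) + q n
      ≡⟨ cong (λ c → ∑[ i < n ] q (toℕ i) + + c * F (suc n) (n ∸ n)) (k>n⇒nCk≡0 (ℕₚ.n<1+n n)) ⟩
    ∑[ i < n ] q (toℕ i) + 0ℤ   ≡⟨ ℤₚ.+-identityʳ _ ⟩
    ∑[ i < n ] q (toℕ i)        ≡⟨ sum-cong-≗ (λ i → cong (λ r → + (n C suc (toℕ i)) * F (suc (toℕ i)) r)
                                                          (ℕₚ.+-∸-assoc 1 {n} (toℕ<n i))) ⟩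
    ∑[ i < n ] (+ (n C suc (toℕ i)) * F (suc (toℕ i)) (suc (n ∸ suc (toℕ i)))) ∎

multinomial-recurrence : ∀ k n (G : Vec ℕ k → ℤ) →
  ∑[ s ∈ compositions k (suc n) ] (multinomialℤ s * G s) ≡
  ∑[ ℓ < k ] ∑[ s ∈ compositions k n ] (multinomialℤ s * G (Vec.updateAt s ℓ suc))
multinomial-recurrence zero    n G = refl
multinomial-recurrence (suc k) n G = begin
  ∑[ s ∈ compositions (suc k) (suc n) ] (multinomialℤ s * G s)
    ≡⟨ ∑-compositions-suc k (suc n) G ⟩
  ∑[ i < suc (suc n) ] (+ (suc n C toℕ i) * rest (toℕ i) (suc n ∸ toℕ i))
    ≡⟨ pascal-∑ n rest ⟩
  ∑[ i < suc n ] (+ (n C toℕ i) * rest (suc (toℕ i)) (n ∸ toℕ i)) +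
  ∑[ i < suc n ] (+ (n C toℕ i) * rest (toℕ i) (suc (n ∸ toℕ i)))
    ≡⟨ cong₂ _+_ (sym (∑-compositions-suc k n (λ s → G (Vec.updateAt s zero suc)))) other-labels ⟩
  ∑[ s ∈ compositions (suc k) n ] (multinomialℤ s * G (Vec.updateAt s zero suc)) +
  ∑[ ℓ < k ] ∑[ s ∈ compositions (suc k) n ] (multinomialℤ s * G (Vec.updateAt s (suc ℓ) suc)) ∎
  where
  open ≡-Reasoning
  rest : ℕ → ℕ → ℤ
  rest x r = ∑[ t ∈ compositions k r ] (multinomialℤ t * G (x ∷ t))
  bumped : Fin k → ℕ → ℤ
  bumped ℓ x = ∑[ t ∈ compositions k (n ∸ x) ] (multinomialℤ t * G (x ∷ Vec.updateAt t ℓ suc))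
  other-labels : ∑[ i < suc n ] (+ (n C toℕ i) * rest (toℕ i) (suc (n ∸ toℕ i))) ≡
                 ∑[ ℓ < k ] ∑[ s ∈ compositions (suc k) n ] (multinomialℤ s * G (Vec.updateAt s (suc ℓ) suc))
  other-labels = begin
    ∑[ i < suc n ] (+ (n C toℕ i) * rest (toℕ i) (suc (n ∸ toℕ i)))
      ≡⟨ sum-cong-≗ (λ (i : Fin (suc n)) →
           cong (+ (n C toℕ i) *_) (multinomial-recurrence k (n ∸ toℕ i) (G ∘ (toℕ i ∷_)))) ⟩
    ∑[ i < suc n ] (+ (n C toℕ i) * ∑[ ℓ < k ] bumped ℓ (toℕ i))
      ≡⟨ sum-cong-≗ (λ (i : Fin (suc n)) → *-distribˡ-sum (+ (n C toℕ i)) (λ ℓ → bumped ℓ (toℕ i))) ⟩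
    ∑[ i < suc n ] ∑[ ℓ < k ] (+ (n C toℕ i) * bumped ℓ (toℕ i))
      ≡⟨ ∑-comm (λ (i : Fin (suc n)) ℓ → + (n C toℕ i) * bumped ℓ (toℕ i)) ⟩
    ∑[ ℓ < k ] ∑[ i < suc n ] (+ (n C toℕ i) * bumped ℓ (toℕ i))
      ≡⟨ sum-cong-≗ (λ ℓ → ∑-compositions-suc k n (λ s → G (Vec.updateAt s (suc ℓ) suc))) ⟨
    ∑[ ℓ < k ] ∑[ s ∈ compositions (suc k) n ] (multinomialℤ s * G (Vec.updateAt s (suc ℓ) suc)) ∎

∑-histogram : ∀ k n (G : Vec ℕ k → ℤ) →
  ∑[ τ ∈ allVecs (allFin k) n ] G (histogram τ) ≡ ∑[ s ∈ compositions k n ] (multinomialℤ s * G s)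
∑-histogram k zero G = begin
  G 0⃗ + 0ℤ                                 ≡⟨ cong (_+ 0ℤ) (ℤₚ.*-identityˡ (G 0⃗)) ⟨
  1ℤ * G 0⃗ + 0ℤ                            ≡⟨ cong (λ m → + m * G 0⃗ + 0ℤ) (multinomial-zero k) ⟨
  multinomialℤ 0⃗ * G 0⃗ + 0ℤ                ≡⟨ cong (λ ss → ∑[ s ∈ ss ] (multinomialℤ s * G s)) (compositions-zero k) ⟨
  ∑[ s ∈ compositions k 0 ] (multinomialℤ s * G s) ∎
  where
  open ≡-Reasoning
  0⃗ = Vec.replicate k 0
∑-histogram k (suc n) G = begin
  ∑[ τ ∈ allVecs (allFin k) (suc n) ] G (histogram τ)
    ≡⟨ ∑∈-allVecs (allFin k) n (G ∘ histogram) ⟩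
  ∑[ ℓ ∈ allFin k ] ∑[ τ ∈ allVecs (allFin k) n ] G (Vec.updateAt (histogram τ) ℓ suc)
    ≡⟨ ∑∈-allFin (λ ℓ → ∑[ τ ∈ allVecs (allFin k) n ] G (Vec.updateAt (histogram τ) ℓ suc)) ⟩
  ∑[ ℓ < k ] ∑[ τ ∈ allVecs (allFin k) n ] G (Vec.updateAt (histogram τ) ℓ suc)
    ≡⟨ sum-cong-≗ (λ ℓ → ∑-histogram k n (λ s → G (Vec.updateAt s ℓ suc))) ⟩
  ∑[ ℓ < k ] ∑[ s ∈ compositions k n ] (multinomialℤ s * G (Vec.updateAt s ℓ suc))
    ≡⟨ multinomial-recurrence k n G ⟨
  ∑[ s ∈ compositions k (suc n) ] (multinomialℤ s * G s) ∎
  where open ≡-Reasoning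

-- The identity also holds for n = 0 (both sides are 1).
mainTheorem6 : (n : ℕ) → n ≥ 1 → + (L₃ n) ≡ RHS n
mainTheorem6 n _ = begin
  + L₃ n
    ≡⟨ latin₃-count n ⟩
  ∑[ τ ∈ labellings n ] (sgn τ * (∑[ v ∈ allVecs (allFin n) 3 ] columnWeight τ v) ^ n)
    ≡⟨ ∑∈-cong (labellings n) (λ τ → cong₂ (λ σ b → σ * b ^ n) (sgn-histogram τ) (∑-columnWeight τ)) ⟩
  ∑[ τ ∈ labellings n ] T (histogram τ)
    ≡⟨ ∑-histogram 8 n T ⟩
  ∑[ s ∈ compositions 8 n ] (multinomialℤ s * T s)
    ≡⟨ ∑∈-cong (compositions 8 n) (λ s → reorder (multinomialℤ s) (-1ℤ ^ signExponent s) (bracket s ^ n)) ⟩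
  RHS n ∎
  where
  open ≡-Reasoning
  T : S → ℤ
  T s = -1ℤ ^ signExponent s * bracket s ^ n
  reorder : ∀ m σ b → m * (σ * b) ≡ σ * m * b
  reorder = solve-∀
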